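{- Let $\langle\Sigma,P\rangle$ be a simple f-hybrid knowledge base, i.e. $\Sigma$ is an $\mathcal{ALCHOQ}$ knowledge base and $P$ is a simple FoLP. Then $\Phi(\Sigma)\cup P$ is a simple FoLP, and $\Phi(\Sigma)$ has a size that is polynomial in the size of $\Sigma$.
   Context: Programs and FoLPs. A program is a finite set of rules $\alpha\leftarrow\beta$ with $\alpha$ a finite set of regular literals (atoms $q(t_1,\dots,t_n)$ or $\mathit{not}\,q(t_1,\dots,t_n)$, terms being constants or variables) and $\beta$ a finite set of literals, possibly also inequalities $s\neq t$; rules with empty head are constraints. With $\beta(s)=\{a(s)\mid a\in\beta\}\cup\{\mathit{not}\,a(s)\mid\mathit{not}\,a\in\beta\}$ (similarly $\gamma(s,t)$), a forest logic program (FoLP) is a program with only unary and binary predicates whose rules are: free rules $a(s)\lor\mathit{not}\,a(s)\leftarrow$, $f(s,t)\lor\mathit{not}\,f(s,t)\leftarrow$; unary rules $a(s)\leftarrow\beta(s),(\gamma_m(s,t_m),\delta_m(t_m))_{1\le m\le k},\psi$ with $\psi\subseteq\{t_i\neq t_j\mid1\le i\neq j\le k\}$; binary rules $f(s,t)\leftarrow\beta(s),\gamma(s,t),\delta(t)$; constraints $\leftarrow a(s)$, $\leftarrow f(s,t)$; with $\beta,\delta,\delta_m$ sets of possibly negated unary predicates, $\gamma,\gamma_m$ sets of possibly negated binary predicates (no (in)equality), $\gamma_m$ (resp. $\gamma$) containing a non-negated predicate when $t_m$ (resp. $t$) is a variable, and variable terms in a rule pairwise distinct. A predicate $q$ is free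 if the program contains $q(X_1,\dots,X_n)\lor\mathit{not}\,q(X_1,\dots,X_n)\leftarrow$ with variables $X_i$. The marked positive predicate dependency graph $D(P)$ has as vertices the non-free predicates of $P$ and an arc $(p,q)$ whenever a unary or binary rule has head predicate $p$ and a non-negated body literal with predicate $q$; the arc is marked if $q$ occurs in some $\delta_m$ of such a unary rule (resp. $\delta$ of such a binary rule). $P$ is a simple FoLP if $D(P)$ has no cycle containing a marked arc. $\mathcal{ALCHOQ}$. Concept expressions are built from atomic concepts and nominals $\{o\}$ using $\neg$, $\sqcap$, $\sqcup$, $\exists R.C$, $\forall R.C$, $\geq n\,S.C$, $\leq n\,S.C$ ($R,S$ role names). An $\mathcal{ALCHOQ}$ knowledge base is a finite set of terminological axioms $C\sqsubseteq D$ and role axioms $R\sqsubseteq S$ (no transitivity axioms). A simple f-hybrid knowledge base is $\langle\Sigma,P\rangle$ with $\Sigma$ an $\mathcal{ALCHOQ}$ KB and $P$ a simple FoLP, whose predicates may be atomic concepts or role names of $\Sigma$. Closure and translation. $\mathrm{clos}(\Sigma)$ is the smallest set such that for every axiom $C\sqsubseteq D\in\Sigma$, $C,D\in\mathrm{clos}(\Sigma)$, and for $D\in\mathrm{clos}(\Sigma)$: $D=\neg D_1\Rightarrow D_1$; $D=D_1\sqcup D_2$ or $D_1\sqcap D_2\Rightarrow D_1,D_2$; $D=\exists R.D_1\Rightarrow R,D_1$; $D=\forall R.D_1\Rightarrow\exists R.\neg D_1$; $D=\leq n\,Q.D_1\Rightarrow\geq(n+1)\,Q.D_1$; $D=\geq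 n\,Q.D_1\Rightarrow Q,D_1$ (all in $\mathrm{clos}(\Sigma)$). Concept expressions of $\mathrm{clos}(\Sigma)$ are unary predicate symbols, role names binary ones. $\Phi(\Sigma)$ contains: $\leftarrow C(X),\mathit{not}\,D(X)$ for each $C\sqsubseteq D$; $\leftarrow R(X,Y),\mathit{not}\,S(X,Y)$ for each $R\sqsubseteq S$; and for each $D\in\mathrm{clos}(\Sigma)$: concept name: $D(X)\lor\mathit{not}\,D(X)\leftarrow$; role name: $D(X,Y)\lor\mathit{not}\,D(X,Y)\leftarrow$; $D=\{o\}$: $D(o)\leftarrow$; $D=\neg E$: $D(X)\leftarrow\mathit{not}\,E(X)$; $D=E\sqcap F$: $D(X)\leftarrow E(X),F(X)$; $D=E\sqcup F$: $D(X)\leftarrow E(X)$ and $D(X)\leftarrow F(X)$; $D=\exists Q.E$: $D(X)\leftarrow Q(X,Y),E(Y)$; $D=\forall R.E$: $D(X)\leftarrow\mathit{not}\,(\exists R.\neg E)(X)$; $D=\leq n\,Q.E$: $D(X)\leftarrow\mathit{not}\,(\geq(n+1)\,Q.E)(X)$; $D=\geq n\,Q.E$: $D(X)\leftarrow Q(X,Y_1),\dots,Q(X,Y_n),E(Y_1),\dots,E(Y_n),(Y_i\neq Y_j)_{1\le i\neq j\le n}$. Size convention: numbers in number restrictions are represented in unary. -}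

module Defs where

open import Data.Nat using (ℕ; zero; suc; _+_; _*_; _^_; _≤_; _≡ᵇ_)
open import Data.Bool using (Bool; true; false; if_then_else_)
open import Data.List using (List; []; _∷_; _++_; map; concatMap; length; lookup; upTo; [_])
open import Data.Nat.ListAction using (sum)
open import Data.List.Membership.Propositional using (_∈_)
open import Data.List.Relation.Unary.All using (All)
open import Data.List.Relation.Unary.Any using (Any)
open import Data.List.Relation.Unary.AllPairs using (AllPairs)
open import Data.List.Relation.Binary.Subset.Propositional using (_⊆_)
open import Data.Fin using (Fin)
open import Data.Unit using (⊤)
open import Data.Product using (Σ; _×_; _,_; ∃; proj₁; proj₂)
open import Relation.Nullary using (¬_)
open import Relation.Binary.PropositionalEquality using (_≡_; _≢_)
open import Relation.Binary.Construct.Closure.ReflexiveTransitive using (Star)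
open import Function.Bundles using (_⇔_)

CName RName Const Var : Set
CName = ℕ
RName = ℕ
Const = ℕ
Var   = ℕ

data Concept : Set where
  cAtom : CName → Concept
  cNom  : Const → Concept
  cNot  : Concept → Concept
  cAnd  : Concept → Concept → Concept
  cOr   : Concept → Concept → Concept
  cSome : RName → Concept → Concept
  cAll  : RName → Concept → Concept
  cGe   : ℕ → RName → Concept → Concept
  cLe   : ℕ → RName → Concept → Concept

-- An ALCHOQ knowledge base: terminological axioms C ⊑ D and role axioms R ⊑ S.
record KB : Set where
  constructor kb
  field
    tbox : List (Concept × Concept)
    rbox : List (RName × RName)
open KB public

-- sizes (numbers in number restrictions in unary)
csize : Concept → ℕ
csize (cAtom _)     = 1
csize (cNom _)      = 1
csize (cNot C)      = suc (csize C)
csize (cAnd C D)    = suc (csize C + csize D)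
csize (cOr C D)     = suc (csize C + csize D)
csize (cSome _ C)   = 2 + csize C
csize (cAll _ C)    = 2 + csize C
csize (cGe n _ C)   = 2 + n + csize C
csize (cLe n _ C)   = 2 + n + csize C

kbSize : KB → ℕ
kbSize K = sum (map (λ { (C , D) → suc (csize C + csize D) }) (tbox K))
         + sum (map (λ _ → 3) (rbox K))

data CElem : Set where
  cc : Concept → CElem
  rr : RName → CElem

data InClos (K : KB) : CElem → Set where
  ax-l  : ∀ {C D} → (C , D) ∈ tbox K → InClos K (cc C)
  ax-r  : ∀ {C D} → (C , D) ∈ tbox K → InClos K (cc D)
  not-s : ∀ {D} → InClos K (cc (cNot D)) → InClos K (cc D)
  or-l  : ∀ {D E} → InClos K (cc (cOr D E)) → InClos K (cc D)
  or-r  : ∀ {D E} → InClos K (cc (cOr D E)) → InClos K (cc E)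
  and-l : ∀ {D E} → InClos K (cc (cAnd D E)) → InClos K (cc D)
  and-r : ∀ {D E} → InClos K (cc (cAnd D E)) → InClos K (cc E)
  ex-r  : ∀ {R D} → InClos K (cc (cSome R D)) → InClos K (rr R)
  ex-c  : ∀ {R D} → InClos K (cc (cSome R D)) → InClos K (cc D)
  all-s : ∀ {R D} → InClos K (cc (cAll R D)) → InClos K (cc (cSome R (cNot D)))
  le-s  : ∀ {n Q D} → InClos K (cc (cLe n Q D)) → InClos K (cc (cGe (suc n) Q D))
  ge-r  : ∀ {n Q D} → InClos K (cc (cGe n Q D)) → InClos K (rr Q)
  ge-c  : ∀ {n Q D} → InClos K (cc (cGe n Q D)) → InClos K (cc D)

-- Programs (unary predicate symbols = concept expressions,
-- binary predicate symbols = role names)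

data Term : Set where
  var : Var → Term
  con : Const → Term

data Atom : Set where
  un  : Concept → Term → Atom
  bin : RName → Term → Term → Atom

data Lit : Set where
  pos : Atom → Lit
  neg : Atom → Lit

data BLit : Set where
  lit : Lit → BLit
  neq : Term → Term → BLit

-- a rule  α ← β  (α, β sets, represented by lists; see _≈R_)
record Rule : Set where
  constructor _⇐_
  field
    hd : List Lit
    bd : List BLit
open Rule public

Program : Set
Program = List Rule

_≈S_ : {A : Set} → List A → List A → Set
xs ≈S ys = (xs ⊆ ys) × (ys ⊆ xs)

_≈R_ : Rule → Rule → Set
r ≈R r' = (hd r ≈S hd r') × (bd r ≈S bd r')

data Sign : Set where
  ⊕ ⊖ : Sign

sgn : Sign → Atom → Lit
sgn ⊕ a = pos a
sgn ⊖ a = neg a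

uLits : Term → List (Sign × Concept) → List BLit
uLits s β = map (λ { (σ , c) → lit (sgn σ (un c s)) }) β

bLits : Term → Term → List (Sign × RName) → List BLit
bLits s t γ = map (λ { (σ , f) → lit (sgn σ (bin f s t)) }) γ

-- one component (γ_m(s,t_m), δ_m(t_m)) of a unary rule body
record Branch : Set where
  constructor branch
  field
    tm : Term
    γm : List (Sign × RName)
    δm : List (Sign × Concept)
open Branch public

branchLits : Term → Branch → List BLit
branchLits s b = bLits s (tm b) (γm b) ++ uLits (tm b) (δm b)

-- ψ given by pairs of indices (i , j), meaning t_i ≠ t_j
Psi : List Branch → Set
Psi ms = List (Fin (length ms) × Fin (length ms))

psiLits : (ms : List Branch) → Psi ms → List BLit
psiLits ms ψ = map (λ { (i , j) → neq (tm (lookup ms i)) (tm (lookup ms j)) }) ψ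

unaryBody : Term → List (Sign × Concept) → (ms : List Branch) → Psi ms → List BLit
unaryBody s β ms ψ = uLits s β ++ concatMap (branchLits s) ms ++ psiLits ms ψ

binaryBody : Term → Term → List (Sign × Concept) → List (Sign × RName)
           → List (Sign × Concept) → List BLit
binaryBody s t β γ δ = uLits s β ++ bLits s t γ ++ uLits t δ

IsVar : Term → Set
IsVar t = ∃ λ x → t ≡ var x

HasPos : {A : Set} → List (Sign × A) → Set
HasPos γ = Any (λ p → proj₁ p ≡ ⊕) γ

VarsDistinct : List Term → Set
VarsDistinct = AllPairs (λ t t' → ∀ x → t ≡ var x → t' ≢ var x)

UnaryOK : Term → (ms : List Branch) → Psi ms → Set
UnaryOK s ms ψ =
    All (λ b → IsVar (tm b) → HasPos (γm b)) ms
  × All (λ ij → proj₁ ij ≢ proj₂ ij) ψ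
  × VarsDistinct (s ∷ map tm ms)

BinaryOK : Term → Term → List (Sign × RName) → Set
BinaryOK s t γ = (IsVar t → HasPos γ) × VarsDistinct (s ∷ t ∷ [])

data Shape : Set where
  freeU   : Concept → Term → Shape
  freeB   : RName → Term → Term → Shape
  unary   : Concept → Term → List (Sign × Concept) → (ms : List Branch) → Psi ms → Shape
  binary  : RName → Term → Term → List (Sign × Concept) → List (Sign × RName)
          → List (Sign × Concept) → Shape
  -- constraints (empty head) whose body has the shape of a unary / binary rule body
  constrU : Term → List (Sign × Concept) → (ms : List Branch) → Psi ms → Shape
  constrB : Term → Term → List (Sign × Concept) → List (Sign × RName)
          → List (Sign × Concept) → Shape

ShapeOK : Shape → Set
ShapeOK (freeU a s)             = ⊤
ShapeOK (freeB f s t)           = VarsDistinct (s ∷ t ∷ [])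
ShapeOK (unary a s β ms ψ)      = UnaryOK s ms ψ
ShapeOK (binary f s t β γ δ)    = BinaryOK s t γ
ShapeOK (constrU s β ms ψ)      = UnaryOK s ms ψ
ShapeOK (constrB s t β γ δ)     = BinaryOK s t γ

toRule : Shape → Rule
toRule (freeU a s)          = (pos (un a s) ∷ neg (un a s) ∷ []) ⇐ []
toRule (freeB f s t)        = (pos (bin f s t) ∷ neg (bin f s t) ∷ []) ⇐ []
toRule (unary a s β ms ψ)   = [ pos (un a s) ] ⇐ unaryBody s β ms ψ
toRule (binary f s t β γ δ) = [ pos (bin f s t) ] ⇐ binaryBody s t β γ δ
toRule (constrU s β ms ψ)   = [] ⇐ unaryBody s β ms ψ
toRule (constrB s t β γ δ)  = [] ⇐ binaryBody s t β γ δ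

FoLPRule : Rule → Set
FoLPRule r = Σ Shape λ w → ShapeOK w × (toRule w ≈R r)

IsFoLP : Program → Set
IsFoLP P = All FoLPRule P

data Pred : Set where
  up : Concept → Pred
  bp : RName → Pred

posOf : {A : Set} → List (Sign × A) → List A
posOf []             = []
posOf ((⊕ , a) ∷ xs) = a ∷ posOf xs
posOf ((⊖ , a) ∷ xs) = posOf xs

-- arcs (p , q , marked?) contributed by a rule with given shape
arcsFrom : Pred → List (Sign × Concept) → List (Sign × RName) → List (Sign × Concept)
         → List (Pred × Pred × Bool)
arcsFrom p β γ δ =
     map (λ c → (p , up c , false)) (posOf β)
  ++ map (λ f → (p , bp f , false)) (posOf γ)
  ++ map (λ c → (p , up c , true)) (posOf δ)

arcs : Shape → List (Pred × Pred × Bool)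
arcs (unary a s β ms ψ) =
  arcsFrom (up a) β [] [] ++ concatMap (λ b → arcsFrom (up a) [] (γm b) (δm b)) ms
arcs (binary f s t β γ δ) = arcsFrom (bp f) β γ δ
arcs _ = []

Free : Program → Pred → Set
Free P (up a) = ∃ λ x →
  Any (λ r → r ≈R ((pos (un a (var x)) ∷ neg (un a (var x)) ∷ []) ⇐ [])) P
Free P (bp f) = ∃ λ x → ∃ λ y → x ≢ y ×
  Any (λ r → r ≈R ((pos (bin f (var x) (var y)) ∷ neg (bin f (var x) (var y)) ∷ []) ⇐ [])) P

ArcM : Program → Pred → Pred → Bool → Set
ArcM P p q m = (¬ Free P p) × (¬ Free P q) ×
  Any (λ r → Σ Shape λ w → ShapeOK w × (toRule w ≈R r) × ((p , q , m) ∈ arcs w)) P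

Arc : Program → Pred → Pred → Set
Arc P p q = ∃ λ m → ArcM P p q m

-- simple FoLP: a FoLP such that D(P) has no cycle containing a marked arc
-- (a marked arc (p,q) lies on a cycle iff p is reachable from q)
SimpleFoLP : Program → Set
SimpleFoLP P = IsFoLP P × (∀ p q → ArcM P p q true → ¬ Star (Arc P) q p)

AtomOK : Atom → Set
AtomOK (un c _)    = ∃ λ A → c ≡ cAtom A
AtomOK (bin _ _ _) = ⊤

LitOK : Lit → Set
LitOK (pos a) = AtomOK a
LitOK (neg a) = AtomOK a

BLitOK : BLit → Set
BLitOK (lit l)   = LitOK l
BLitOK (neq _ _) = ⊤

AtomicPreds : Program → Set
AtomicPreds P = All (λ r → All LitOK (hd r) × All BLitOK (bd r)) P

SimpleFHybrid : KB → Program → Set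
SimpleFHybrid K P = AtomicPreds P × SimpleFoLP P

vX : Term
vX = var 0

vY : Term
vY = var 1

-- indices 1 … n for Y₁ … Yₙ  (Yᵢ = var i)
ys : ℕ → List ℕ
ys n = map suc (upTo n)

geBody : ℕ → RName → Concept → List BLit
geBody n Q E =
     map (λ i → lit (pos (bin Q vX (var i)))) (ys n)
  ++ map (λ i → lit (pos (un E (var i)))) (ys n)
  ++ concatMap (λ i → concatMap (λ j → if i ≡ᵇ j then [] else [ neq (var i) (var j) ]) (ys n)) (ys n)

data InΦ (K : KB) : Rule → Set where
  φ-tbox : ∀ {C D} → (C , D) ∈ tbox K →
           InΦ K ([] ⇐ (lit (pos (un C vX)) ∷ lit (neg (un D vX)) ∷ []))
  φ-rbox : ∀ {R S} → (R , S) ∈ rbox K →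
           InΦ K ([] ⇐ (lit (pos (bin R vX vY)) ∷ lit (neg (bin S vX vY)) ∷ []))
  φ-atom : ∀ {A} → InClos K (cc (cAtom A)) →
           InΦ K ((pos (un (cAtom A) vX) ∷ neg (un (cAtom A) vX) ∷ []) ⇐ [])
  φ-role : ∀ {R} → InClos K (rr R) →
           InΦ K ((pos (bin R vX vY) ∷ neg (bin R vX vY) ∷ []) ⇐ [])
  φ-nom  : ∀ {o} → InClos K (cc (cNom o)) →
           InΦ K ([ pos (un (cNom o) (con o)) ] ⇐ [])
  φ-not  : ∀ {E} → InClos K (cc (cNot E)) →
           InΦ K ([ pos (un (cNot E) vX) ] ⇐ [ lit (neg (un E vX)) ])
  φ-and  : ∀ {E F} → InClos K (cc (cAnd E F)) →
           InΦ K ([ pos (un (cAnd E F) vX) ] ⇐ (lit (pos (un E vX)) ∷ lit (pos (un F vX)) ∷ []))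
  φ-or-l : ∀ {E F} → InClos K (cc (cOr E F)) →
           InΦ K ([ pos (un (cOr E F) vX) ] ⇐ [ lit (pos (un E vX)) ])
  φ-or-r : ∀ {E F} → InClos K (cc (cOr E F)) →
           InΦ K ([ pos (un (cOr E F) vX) ] ⇐ [ lit (pos (un F vX)) ])
  φ-some : ∀ {Q E} → InClos K (cc (cSome Q E)) →
           InΦ K ([ pos (un (cSome Q E) vX) ] ⇐ (lit (pos (bin Q vX vY)) ∷ lit (pos (un E vY)) ∷ []))
  φ-all  : ∀ {R E} → InClos K (cc (cAll R E)) →
           InΦ K ([ pos (un (cAll R E) vX) ] ⇐ [ lit (neg (un (cSome R (cNot E)) vX)) ])
  φ-le   : ∀ {n Q E} → InClos K (cc (cLe n Q E)) →
           InΦ K ([ pos (un (cLe n Q E) vX) ] ⇐ [ lit (neg (un (cGe (suc n) Q E) vX)) ])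
  φ-ge   : ∀ {n Q E} → InClos K (cc (cGe n Q E)) →
           InΦ K ([ pos (un (cGe n Q E) vX) ] ⇐ geBody n Q E)

-- L is a (finite, list) presentation of the set Φ(Σ)
IsΦ : KB → Program → Set
IsΦ K L = ∀ r → (r ∈ L) ⇔ InΦ K r

-- Size of programs (each predicate symbol / term counts 1)

atomSize : Atom → ℕ
atomSize (un _ _)    = 2
atomSize (bin _ _ _) = 3

litSize : Lit → ℕ
litSize (pos a) = atomSize a
litSize (neg a) = suc (atomSize a)

blitSize : BLit → ℕ
blitSize (lit l)   = litSize l
blitSize (neq _ _) = 3

ruleSize : Rule → ℕ
ruleSize r = suc (sum (map litSize (hd r)) + sum (map blitSize (bd r)))

progSize : Program → ℕ
progSize P = sum (map ruleSize P)

module Submission where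

-- Size: clos(Σ) has at most 2|Σ| elements, each of size at most |Σ| + 1, and
-- the rules of an element of size m cost at most 16(m+1)² (the ≥ n Q.E rule
-- has n² inequalities); hence |Φ(Σ)| ≤ 6|Σ| + 32|Σ|(|Σ|+2)² ≤ 300|Σ|³ + 300.
--
-- Ranking a
-- predicate by the size of its concept expression, and atomic concepts and
-- roles by 0, every arc of D(Φ(Σ) ∪ P) contributed by Φ(Σ) strictly decreases
-- the rank, while the arcs contributed by P join rank-0 predicates.  So a
-- cycle through a marked arc never uses Φ(Σ) and is already a cycle of D(P).

open import Defs
open import Data.Nat using (ℕ; zero; suc; _+_; _*_; _^_; _≤_; _<_; _≡ᵇ_; z≤n; s≤s)
open import Data.Nat.Properties
open import Data.Nat.Tactic.RingSolver using (solve-∀)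
open import Data.Nat.ListAction using (sum)
open import Data.Nat.ListAction.Properties using (sum-++)
open import Data.Bool using (true; false; if_then_else_; T)
open import Data.List using (List; []; _∷_; _++_; map; concatMap; length; lookup; upTo; [_]; allFin; filter; cartesianProduct)
open import Data.List.Properties using (length-map; length-++; map-++; length-upTo; ++-assoc; map-∘)
open import Data.List.Membership.Propositional using (_∈_; find; lose)
open import Data.List.Membership.Propositional.Properties
  using (∈-map⁺; ∈-map⁻; ∈-++⁺ˡ; ∈-++⁺ʳ; ∈-++⁻; ∈-concatMap⁺; ∈-concatMap⁻; ∈-lookup; ∈-allFin;
         ∈-filter⁺; ∈-filter⁻; ∈-cartesianProduct⁺)
open import Data.List.Relation.Unary.All as All using ([]; _∷_)
import Data.List.Relation.Unary.All.Properties as AllP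
open import Data.List.Relation.Unary.Any as Any using (here; there)
import Data.List.Relation.Unary.Any.Properties as AnyP
open import Data.List.Relation.Unary.AllPairs using (AllPairs; []; _∷_) renaming (map to AllPairs-map)
import Data.List.Relation.Unary.AllPairs.Properties as AllPairsP
open import Data.List.Relation.Binary.Subset.Propositional using (_⊆_)
open import Data.List.Relation.Binary.Subset.Propositional.Properties using (⊆-trans; ⊆-reflexive; ++⁺)
open import Data.Fin using (Fin)
open import Data.Unit using (tt)
open import Data.Empty using (⊥-elim)
open import Data.Sum using (_⊎_; inj₁; inj₂)
open import Data.Product using (Σ; _×_; _,_; ∃; proj₁; proj₂)
open import Function using (_∘_)
open import Relation.Nullary using (¬_; Dec; yes; no; ¬?)
open import Relation.Nullary.Decidable using (True; toWitness)
open import Relation.Binary.PropositionalEquality using (_≡_; _≢_; refl; sym; trans; cong; cong₂; subst)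
open import Relation.Binary.Construct.Closure.ReflexiveTransitive using (Star; ε; _◅_)
open import Function.Bundles using (mk⇔; Equivalence)

∈-concatMap-intro : ∀ {A B : Set} (f : A → List B) {xs : List A} {x : A} {y : B} →
                    x ∈ xs → y ∈ f x → y ∈ concatMap f xs
∈-concatMap-intro f x∈xs y∈fx = ∈-concatMap⁺ f (lose x∈xs y∈fx)

∈-concatMap-elim : ∀ {A B : Set} (f : A → List B) (xs : List A) {y : B} →
                   y ∈ concatMap f xs → ∃ λ x → x ∈ xs × y ∈ f x
∈-concatMap-elim f xs y∈ = find (∈-concatMap⁻ f y∈)

sum-map-++ : ∀ {A : Set} (g : A → ℕ) xs ys →
             sum (map g (xs ++ ys)) ≡ sum (map g xs) + sum (map g ys)
sum-map-++ g xs ys = trans (cong sum (map-++ g xs ys)) (sum-++ (map g xs) (map g ys))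

progSize-++ : ∀ xs ys → progSize (xs ++ ys) ≡ progSize xs + progSize ys
progSize-++ = sum-map-++ ruleSize

sum-map-∈ : ∀ {A : Set} (g : A → ℕ) {x xs} → x ∈ xs → g x ≤ sum (map g xs)
sum-map-∈ g (here refl) = m≤m+n _ _
sum-map-∈ g {xs = y ∷ _} (there p) = ≤-trans (sum-map-∈ g p) (m≤n+m _ (g y))

sum-concatMap-≤ : ∀ {A B : Set} (g : B → ℕ) (f : A → List B) k xs →
                  (∀ {x} → x ∈ xs → sum (map g (f x)) ≤ k) →
                  sum (map g (concatMap f xs)) ≤ length xs * k
sum-concatMap-≤ g f k []       _ = z≤n
sum-concatMap-≤ g f k (x ∷ xs) b = begin
  sum (map g (f x ++ concatMap f xs))               ≡⟨ sum-map-++ g (f x) _ ⟩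
  sum (map g (f x)) + sum (map g (concatMap f xs))  ≤⟨ +-mono-≤ (b (here refl)) (sum-concatMap-≤ g f k xs (b ∘ there)) ⟩
  k + length xs * k                                 ∎
  where open ≤-Reasoning

length-concatMap-≤ : ∀ {A B : Set} (f : A → List B) (h : A → ℕ) k xs →
                     (∀ x → length (f x) ≤ k * h x) → length (concatMap f xs) ≤ k * sum (map h xs)
length-concatMap-≤ f h k []       _ = z≤n
length-concatMap-≤ f h k (x ∷ xs) b = begin
  length (f x ++ concatMap f xs)          ≡⟨ length-++ (f x) ⟩
  length (f x) + length (concatMap f xs)  ≤⟨ +-mono-≤ (b x) (length-concatMap-≤ f h k xs b) ⟩
  k * h x + k * sum (map h xs)            ≡⟨ *-distribˡ-+ k (h x) _ ⟨
  k * (h x + sum (map h xs))              ∎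
  where open ≤-Reasoning

sum-map-∘-≤ : ∀ {A B : Set} (g : B → ℕ) (f : A → B) k xs →
              (∀ x → g (f x) ≤ k) → sum (map g (map f xs)) ≤ length xs * k
sum-map-∘-≤ g f k []       _ = z≤n
sum-map-∘-≤ g f k (x ∷ xs) b = +-mono-≤ (b x) (sum-map-∘-≤ g f k xs b)

sum-map-∘-scaled : ∀ {A B : Set} (g : B → ℕ) (f : A → B) (h : A → ℕ) k xs →
                   (∀ x → g (f x) ≤ k * h x) → sum (map g (map f xs)) ≤ k * sum (map h xs)
sum-map-∘-scaled g f h k []       _ = z≤n
sum-map-∘-scaled g f h k (x ∷ xs) b = begin
  g (f x) + sum (map g (map f xs)) ≤⟨ +-mono-≤ (b x) (sum-map-∘-scaled g f h k xs b) ⟩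
  k * h x + k * sum (map h xs)     ≡⟨ *-distribˡ-+ k (h x) _ ⟨
  k * (h x + sum (map h xs))       ∎
  where open ≤-Reasoning

≤-by-slack : ∀ {a b} k → a + k ≡ b → a ≤ b
≤-by-slack {a} k eq = subst (a ≤_) eq (m≤m+n a k)

lit-≤ : ∀ {m n} → {m≤n : True (m ≤? n)} → m ≤ n
lit-≤ {m≤n = m≤n} = toWitness m≤n

-- `sub C` lists C together with `below C`, everything else clos(Σ) is forced
-- to contain once it contains C.
sub   : Concept → List CElem
below : Concept → List CElem

sub C = cc C ∷ below C

below (cAtom _)   = []
below (cNom _)    = []
below (cNot D)    = sub D
below (cAnd D E)  = sub D ++ sub E
below (cOr D E)   = sub D ++ sub E
below (cSome R D) = rr R ∷ sub D
below (cAll R D)  = cc (cSome R (cNot D)) ∷ rr R ∷ cc (cNot D) ∷ sub D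
below (cGe n Q D) = rr Q ∷ sub D
below (cLe n Q D) = cc (cGe (suc n) Q D) ∷ rr Q ∷ sub D

sub-closed    : ∀ C {D} → cc D ∈ sub C → sub D ⊆ sub C
below-closed  : ∀ C {D} → cc D ∈ below C → sub D ⊆ below C
sub-closed-++ : ∀ C D {E} → cc E ∈ sub C ++ sub D → sub E ⊆ sub C ++ sub D

sub-closed C (here refl) = λ x∈ → x∈
sub-closed C (there p)   = there ∘ below-closed C p

below-closed (cNot D)    p = sub-closed D p
below-closed (cAnd D E)  p = sub-closed-++ D E p
below-closed (cOr D E)   p = sub-closed-++ D E p
below-closed (cSome R D) (there p) = there ∘ sub-closed D p
below-closed (cAll R D)  (here refl) = λ x∈ → x∈
below-closed (cAll R D)  (there (there (here refl))) = there ∘ there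
below-closed (cAll R D)  (there (there (there p))) = there ∘ there ∘ there ∘ sub-closed D p
below-closed (cGe n Q D) (there p) = there ∘ sub-closed D p
below-closed (cLe n Q D) (here refl) = λ x∈ → x∈
below-closed (cLe n Q D) (there (there p)) = there ∘ there ∘ sub-closed D p

sub-closed-++ C D p with ∈-++⁻ (sub C) p
... | inj₁ q = ∈-++⁺ˡ ∘ sub-closed C q
... | inj₂ q = ∈-++⁺ʳ (sub C) ∘ sub-closed D q

sub-sound    : ∀ {K} C {x} → InClos K (cc C) → x ∈ sub C → InClos K x
below-sound  : ∀ {K} C {x} → InClos K (cc C) → x ∈ below C → InClos K x
sub-sound-++ : ∀ {K} C D {x} → InClos K (cc C) → InClos K (cc D) →
               x ∈ sub C ++ sub D → InClos K x

sub-sound C h (here refl) = h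
sub-sound C h (there p)   = below-sound C h p

below-sound (cNot D)    h p = sub-sound D (not-s h) p
below-sound (cAnd D E)  h p = sub-sound-++ D E (and-l h) (and-r h) p
below-sound (cOr D E)   h p = sub-sound-++ D E (or-l h) (or-r h) p
below-sound (cSome R D) h (here refl) = ex-r h
below-sound (cSome R D) h (there p) = sub-sound D (ex-c h) p
below-sound (cAll R D)  h (here refl) = all-s h
below-sound (cAll R D)  h (there (here refl)) = ex-r (all-s h)
below-sound (cAll R D)  h (there (there (here refl))) = ex-c (all-s h)
below-sound (cAll R D)  h (there (there (there p))) = sub-sound D (not-s (ex-c (all-s h))) p
below-sound (cGe n Q D) h (here refl) = ge-r h
below-sound (cGe n Q D) h (there p) = sub-sound D (ge-c h) p
below-sound (cLe n Q D) h (here refl) = le-s h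
below-sound (cLe n Q D) h (there (here refl)) = ge-r (le-s h)
below-sound (cLe n Q D) h (there (there p)) = sub-sound D (ge-c (le-s h)) p

sub-sound-++ C D hC hD p with ∈-++⁻ (sub C) p
... | inj₁ q = sub-sound C hC q
... | inj₂ q = sub-sound D hD q

axiomSub : Concept × Concept → List CElem
axiomSub (C , D) = sub C ++ sub D

closList : KB → List CElem
closList K = concatMap axiomSub (tbox K)

closList-sound : ∀ {K x} → x ∈ closList K → InClos K x
closList-sound {K} p with ∈-concatMap-elim axiomSub (tbox K) p
... | (C , D) , ax , q = sub-sound-++ C D (ax-l ax) (ax-r ax) q

closList-closed : ∀ K {C x} → cc C ∈ closList K → x ∈ sub C → x ∈ closList K
closList-closed K p x∈ with ∈-concatMap-elim axiomSub (tbox K) p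
... | (C , D) , ax , q = ∈-concatMap-intro axiomSub ax (sub-closed-++ C D q x∈)

-- Every closure condition defining clos(Σ) is mirrored by `sub`, so closList
-- contains all of clos(Σ).
closList-complete : ∀ {K x} → InClos K x → x ∈ closList K
closList-complete (ax-l ax)           = ∈-concatMap-intro axiomSub ax (here refl)
closList-complete (ax-r {C} ax)       = ∈-concatMap-intro axiomSub ax (∈-++⁺ʳ (sub C) (here refl))
closList-complete {K} (not-s h)       = closList-closed K (closList-complete h) (there (here refl))
closList-complete {K} (or-l h)        = closList-closed K (closList-complete h) (there (here refl))
closList-complete {K} (or-r {D} h)    = closList-closed K (closList-complete h) (there (∈-++⁺ʳ (sub D) (here refl)))
closList-complete {K} (and-l h)       = closList-closed K (closList-complete h) (there (here refl))
closList-complete {K} (and-r {D} h)   = closList-closed K (closList-complete h) (there (∈-++⁺ʳ (sub D) (here refl)))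
closList-complete {K} (ex-r h)        = closList-closed K (closList-complete h) (there (here refl))
closList-complete {K} (ex-c h)        = closList-closed K (closList-complete h) (there (there (here refl)))
closList-complete {K} (all-s h)       = closList-closed K (closList-complete h) (there (here refl))
closList-complete {K} (le-s h)        = closList-closed K (closList-complete h) (there (here refl))
closList-complete {K} (ge-r h)        = closList-closed K (closList-complete h) (there (here refl))
closList-complete {K} (ge-c h)        = closList-closed K (closList-complete h) (there (there (here refl)))

tboxRule : Concept × Concept → Rule
tboxRule (C , D) = [] ⇐ (lit (pos (un C vX)) ∷ lit (neg (un D vX)) ∷ [])

rboxRule : RName × RName → Rule
rboxRule (R , S) = [] ⇐ (lit (pos (bin R vX vY)) ∷ lit (neg (bin S vX vY)) ∷ [])

rulesOf : CElem → List Rule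
rulesOf (rr R)           = [ (pos (bin R vX vY) ∷ neg (bin R vX vY) ∷ []) ⇐ [] ]
rulesOf (cc (cAtom A))   = [ (pos (un (cAtom A) vX) ∷ neg (un (cAtom A) vX) ∷ []) ⇐ [] ]
rulesOf (cc (cNom o))    = [ [ pos (un (cNom o) (con o)) ] ⇐ [] ]
rulesOf (cc (cNot E))    = [ [ pos (un (cNot E) vX) ] ⇐ [ lit (neg (un E vX)) ] ]
rulesOf (cc (cAnd E F))  = [ [ pos (un (cAnd E F) vX) ] ⇐ (lit (pos (un E vX)) ∷ lit (pos (un F vX)) ∷ []) ]
rulesOf (cc (cOr E F))   = ([ pos (un (cOr E F) vX) ] ⇐ [ lit (pos (un E vX)) ])
                         ∷ ([ pos (un (cOr E F) vX) ] ⇐ [ lit (pos (un F vX)) ]) ∷ []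
rulesOf (cc (cSome Q E)) = [ [ pos (un (cSome Q E) vX) ] ⇐ (lit (pos (bin Q vX vY)) ∷ lit (pos (un E vY)) ∷ []) ]
rulesOf (cc (cAll R E))  = [ [ pos (un (cAll R E) vX) ] ⇐ [ lit (neg (un (cSome R (cNot E)) vX)) ] ]
rulesOf (cc (cLe n Q E)) = [ [ pos (un (cLe n Q E) vX) ] ⇐ [ lit (neg (un (cGe (suc n) Q E) vX)) ] ]
rulesOf (cc (cGe n Q E)) = [ [ pos (un (cGe n Q E) vX) ] ⇐ geBody n Q E ]

LΦ : KB → Program
LΦ K = map tboxRule (tbox K) ++ map rboxRule (rbox K) ++ concatMap rulesOf (closList K)

rulesOf-sound : ∀ {K x r} → InClos K x → r ∈ rulesOf x → InΦ K r
rulesOf-sound {x = rr R}           h (here refl) = φ-role h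
rulesOf-sound {x = cc (cAtom A)}   h (here refl) = φ-atom h
rulesOf-sound {x = cc (cNom o)}    h (here refl) = φ-nom h
rulesOf-sound {x = cc (cNot E)}    h (here refl) = φ-not h
rulesOf-sound {x = cc (cAnd E F)}  h (here refl) = φ-and h
rulesOf-sound {x = cc (cOr E F)}   h (here refl) = φ-or-l h
rulesOf-sound {x = cc (cOr E F)}   h (there (here refl)) = φ-or-r h
rulesOf-sound {x = cc (cSome Q E)} h (here refl) = φ-some h
rulesOf-sound {x = cc (cAll R E)}  h (here refl) = φ-all h
rulesOf-sound {x = cc (cLe n Q E)} h (here refl) = φ-le h
rulesOf-sound {x = cc (cGe n Q E)} h (here refl) = φ-ge h

LΦ-sound : ∀ K {r} → r ∈ LΦ K → InΦ K r
LΦ-sound K p with ∈-++⁻ (map tboxRule (tbox K)) p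
... | inj₁ q with ∈-map⁻ tboxRule q
...   | _ , ax , refl = φ-tbox ax
LΦ-sound K p | inj₂ q with ∈-++⁻ (map rboxRule (rbox K)) q
... | inj₁ q' with ∈-map⁻ rboxRule q'
...   | _ , ax , refl = φ-rbox ax
LΦ-sound K p | inj₂ q | inj₂ q' with ∈-concatMap-elim rulesOf (closList K) q'
... | x , x∈ , r∈ = rulesOf-sound (closList-sound x∈) r∈

rulesOf-in-LΦ : ∀ K {x r} → InClos K x → r ∈ rulesOf x → r ∈ LΦ K
rulesOf-in-LΦ K h r∈ =
  ∈-++⁺ʳ (map tboxRule (tbox K)) (∈-++⁺ʳ (map rboxRule (rbox K))
    (∈-concatMap-intro rulesOf (closList-complete h) r∈))

LΦ-complete : ∀ K {r} → InΦ K r → r ∈ LΦ K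
LΦ-complete K (φ-tbox ax) = ∈-++⁺ˡ (∈-map⁺ tboxRule ax)
LΦ-complete K (φ-rbox ax) = ∈-++⁺ʳ (map tboxRule (tbox K)) (∈-++⁺ˡ (∈-map⁺ rboxRule ax))
LΦ-complete K (φ-atom h)  = rulesOf-in-LΦ K h (here refl)
LΦ-complete K (φ-role h)  = rulesOf-in-LΦ K h (here refl)
LΦ-complete K (φ-nom h)   = rulesOf-in-LΦ K h (here refl)
LΦ-complete K (φ-not h)   = rulesOf-in-LΦ K h (here refl)
LΦ-complete K (φ-and h)   = rulesOf-in-LΦ K h (here refl)
LΦ-complete K (φ-or-l h)  = rulesOf-in-LΦ K h (here refl)
LΦ-complete K (φ-or-r h)  = rulesOf-in-LΦ K h (there (here refl))
LΦ-complete K (φ-some h)  = rulesOf-in-LΦ K h (here refl)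
LΦ-complete K (φ-all h)   = rulesOf-in-LΦ K h (here refl)
LΦ-complete K (φ-le h)    = rulesOf-in-LΦ K h (here refl)
LΦ-complete K (φ-ge h)    = rulesOf-in-LΦ K h (here refl)

LΦ-isΦ : ∀ K → IsΦ K (LΦ K)
LΦ-isΦ K r = mk⇔ (LΦ-sound K) (LΦ-complete K)

neqFor : ℕ → ℕ → List BLit
neqFor i j = if i ≡ᵇ j then [] else [ neq (var i) (var j) ]

neqFor⁻ : ∀ i j {l} → l ∈ neqFor i j → i ≢ j × l ≡ neq (var i) (var j)
neqFor⁻ i j l∈ with i ≡ᵇ j in eq
neqFor⁻ i j (here refl) | false = (λ i≡j → subst T eq (≡⇒≡ᵇ i j i≡j)) , refl

neqFor⁺ : ∀ i j → i ≢ j → neq (var i) (var j) ∈ neqFor i j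
neqFor⁺ i j i≢j with i ≡ᵇ j in eq
... | true  = ⊥-elim (i≢j (≡ᵇ⇒≡ i j (subst T (sym eq) tt)))
... | false = here refl

module AtLeastBody (n : ℕ) (Q : RName) (E : Concept) where

  roleAt conceptAt : ℕ → BLit
  roleAt i    = lit (pos (bin Q vX (var i)))
  conceptAt i = lit (pos (un E (var i)))

  -- geBody n Q E is, by definition, roles ++ concepts ++ neqs.
  roles concepts neqs : List BLit
  roles    = map roleAt (ys n)
  concepts = map conceptAt (ys n)
  neqs     = concatMap (λ i → concatMap (neqFor i) (ys n)) (ys n)

celemSize : CElem → ℕ
celemSize (cc C) = csize C
celemSize (rr _) = 0

axiomSize : Concept × Concept → ℕ
axiomSize (C , D) = suc (csize C + csize D)

-- k + a ≤ 2(c + b): the shape of every inductive step of `sub-length`.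
double-+ : ∀ c b {k a} → k ≤ 2 * c → a ≤ 2 * b → k + a ≤ 2 * (c + b)
double-+ c b k≤ a≤ = ≤-trans (+-mono-≤ k≤ a≤) (≤-reflexive (sym (*-distribˡ-+ 2 c b)))

sub-length    : ∀ C → length (sub C) ≤ 2 * csize C
sub-length-++ : ∀ C D → length (sub C ++ sub D) ≤ 2 * (csize C + csize D)

sub-length (cAtom _)   = s≤s z≤n
sub-length (cNom _)    = s≤s z≤n
sub-length (cNot D)    = double-+ 1 (csize D) (s≤s z≤n) (sub-length D)
sub-length (cAnd D E)  = double-+ 1 (csize D + csize E) (s≤s z≤n) (sub-length-++ D E)
sub-length (cOr D E)   = double-+ 1 (csize D + csize E) (s≤s z≤n) (sub-length-++ D E)
sub-length (cSome R D) = double-+ 2 (csize D) (s≤s (s≤s z≤n)) (sub-length D)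
sub-length (cAll R D)  = double-+ 2 (csize D) ≤-refl (sub-length D)
sub-length (cGe n Q D) = double-+ (2 + n) (csize D) (s≤s (s≤s z≤n)) (sub-length D)
sub-length (cLe n Q D) = double-+ (2 + n) (csize D) (≤-trans (n≤1+n 3) (*-monoʳ-≤ 2 (m≤m+n 2 n))) (sub-length D)

sub-length-++ C D =
  ≤-trans (≤-reflexive (length-++ (sub C))) (double-+ (csize C) (csize D) (sub-length C) (sub-length D))

-- Every element of sub C is at most one symbol larger than C
-- (the extra symbol is the ¬ in ∃R.¬D, listed for ∀R.D).
sub-size   : ∀ C {x} → x ∈ sub C → celemSize x ≤ suc (csize C)
below-size : ∀ C {x} → x ∈ below C → celemSize x ≤ suc (csize C)
sub-size-≤ : ∀ D {m x} → csize D ≤ m → x ∈ sub D → celemSize x ≤ suc m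
sub-size-++ : ∀ D E {x} → x ∈ sub D ++ sub E → celemSize x ≤ suc (suc (csize D + csize E))

sub-size C (here refl) = n≤1+n _
sub-size C (there p)   = below-size C p

below-size (cNot D)    p = sub-size-≤ D (n≤1+n _) p
below-size (cAnd D E)  p = sub-size-++ D E p
below-size (cOr D E)   p = sub-size-++ D E p
below-size (cSome R D) (here refl) = z≤n
below-size (cSome R D) (there p)   = sub-size-≤ D (m≤n+m _ 2) p
below-size (cAll R D)  (here refl) = ≤-refl
below-size (cAll R D)  (there (here refl)) = z≤n
below-size (cAll R D)  (there (there (here refl))) = m≤n+m _ 2
below-size (cAll R D)  (there (there (there p))) = sub-size-≤ D (m≤n+m _ 2) p
below-size (cGe n Q D) (here refl) = z≤n
below-size (cGe n Q D) (there p)   = sub-size-≤ D (m≤n+m _ (2 + n)) p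
below-size (cLe n Q D) (here refl) = ≤-refl
below-size (cLe n Q D) (there (here refl)) = z≤n
below-size (cLe n Q D) (there (there p))   = sub-size-≤ D (m≤n+m _ (2 + n)) p

sub-size-≤ D le p = ≤-trans (sub-size D p) (s≤s le)

sub-size-++ D E p with ∈-++⁻ (sub D) p
... | inj₁ q = sub-size-≤ D (≤-trans (m≤m+n _ _) (n≤1+n _)) q
... | inj₂ q = sub-size-≤ E (≤-trans (m≤n+m _ _) (n≤1+n _)) q

axiom-≤-kbSize : ∀ K {a} → a ∈ tbox K → axiomSize a ≤ kbSize K
axiom-≤-kbSize K ax = ≤-trans (sum-map-∈ axiomSize ax) (m≤m+n _ _)

closList-size : ∀ K {x} → x ∈ closList K → celemSize x ≤ suc (kbSize K)
closList-size K p with ∈-concatMap-elim axiomSub (tbox K) p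
... | (C , D) , ax , q = ≤-trans (sub-size-++ C D q) (s≤s (axiom-≤-kbSize K ax))

closList-length : ∀ K → length (closList K) ≤ 2 * kbSize K
closList-length K =
  ≤-trans (length-concatMap-≤ axiomSub axiomSize 2 (tbox K) bound)
          (*-monoʳ-≤ 2 (m≤m+n (sum (map axiomSize (tbox K))) _))
  where
  bound : ∀ a → length (axiomSub a) ≤ 2 * axiomSize a
  bound (C , D) = ≤-trans (sub-length-++ C D) (*-monoʳ-≤ 2 (n≤1+n _))

ruleBudget : ℕ → ℕ
ruleBudget m = 16 * (suc m * suc m)

ruleBudget-mono : ∀ {m m'} → m ≤ m' → ruleBudget m ≤ ruleBudget m'
ruleBudget-mono p = *-monoʳ-≤ 16 (*-mono-≤ (s≤s p) (s≤s p))

≤-ruleBudget : ∀ {k} m → k ≤ 16 → k ≤ ruleBudget m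
≤-ruleBudget m k≤16 = ≤-trans k≤16 (m≤m*n 16 (suc m * suc m))

length-ys : ∀ n → length (ys n) ≡ n
length-ys n = trans (length-map suc (upTo n)) (length-upTo n)

-- The body of the ≥ n Q.E rule: n role atoms, n concept atoms, n² inequalities.
geBody-size : ∀ n Q E → sum (map blitSize (geBody n Q E)) ≤ n * 3 + (n * 2 + n * (n * 3))
geBody-size n Q E = begin
  sumB (roles ++ concepts ++ neqs)                   ≡⟨ sum-map-++ blitSize roles _ ⟩
  sumB roles + sumB (concepts ++ neqs)               ≡⟨ cong (sumB roles +_) (sum-map-++ blitSize concepts neqs) ⟩
  sumB roles + (sumB concepts + sumB neqs)           ≤⟨ +-mono-≤ (sum-map-∘-≤ blitSize roleAt 3 (ys n) (λ _ → ≤-refl))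
                                                          (+-mono-≤ (sum-map-∘-≤ blitSize conceptAt 2 (ys n) (λ _ → ≤-refl))
                                                                    neqs-size) ⟩
  ℓ * 3 + (ℓ * 2 + ℓ * (ℓ * 3))                      ≡⟨ cong (λ k → k * 3 + (k * 2 + k * (k * 3))) (length-ys n) ⟩
  n * 3 + (n * 2 + n * (n * 3))                      ∎
  where
  open ≤-Reasoning
  open AtLeastBody n Q E
  ℓ = length (ys n)
  sumB : List BLit → ℕ
  sumB xs = sum (map blitSize xs)
  neqFor-size : ∀ i j → sumB (neqFor i j) ≤ 3
  neqFor-size i j with i ≡ᵇ j
  ... | true  = z≤n
  ... | false = ≤-refl
  neqs-size : sumB neqs ≤ ℓ * (ℓ * 3)
  neqs-size = sum-concatMap-≤ blitSize _ (ℓ * 3) (ys n)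
                (λ {i} _ → sum-concatMap-≤ blitSize (neqFor i) 3 (ys n) (λ {j} _ → neqFor-size i j))

-- 3 + 5n + 3n² ≤ 16(n+1)², with the slack written out.
ge-identity : ∀ n → 3 + (n * 3 + (n * 2 + n * (n * 3))) + (13 + (n * 27 + n * (n * 13)))
                  ≡ 16 * (suc n * suc n)
ge-identity = solve-∀

-- Only the ≥ rule is not of constant size.
rulesOf-size : ∀ x → progSize (rulesOf x) ≤ ruleBudget (celemSize x)
rulesOf-size (rr R)             = ≤-ruleBudget 0 lit-≤
rulesOf-size x@(cc (cAtom A))   = ≤-ruleBudget (celemSize x) lit-≤
rulesOf-size x@(cc (cNom o))    = ≤-ruleBudget (celemSize x) lit-≤
rulesOf-size x@(cc (cNot E))    = ≤-ruleBudget (celemSize x) lit-≤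
rulesOf-size x@(cc (cAnd E F))  = ≤-ruleBudget (celemSize x) lit-≤
rulesOf-size x@(cc (cOr E F))   = ≤-ruleBudget (celemSize x) lit-≤
rulesOf-size x@(cc (cSome Q E)) = ≤-ruleBudget (celemSize x) lit-≤
rulesOf-size x@(cc (cAll R E))  = ≤-ruleBudget (celemSize x) lit-≤
rulesOf-size x@(cc (cLe n Q E)) = ≤-ruleBudget (celemSize x) lit-≤
rulesOf-size (cc (cGe n Q E))   = begin
  3 + sum (map blitSize (geBody n Q E)) + 0       ≡⟨ +-identityʳ _ ⟩
  3 + sum (map blitSize (geBody n Q E))           ≤⟨ +-monoʳ-≤ 3 (geBody-size n Q E) ⟩
  3 + (n * 3 + (n * 2 + n * (n * 3)))             ≤⟨ ≤-by-slack _ (ge-identity n) ⟩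
  ruleBudget n                                    ≤⟨ ruleBudget-mono (≤-trans (m≤n+m n 2) (m≤m+n (2 + n) (csize E))) ⟩
  ruleBudget (2 + n + csize E)                    ∎
  where open ≤-Reasoning

axiomRules-size : ∀ K → progSize (map tboxRule (tbox K)) + progSize (map rboxRule (rbox K))
                        ≤ 6 * kbSize K
axiomRules-size K = begin
  progSize (map tboxRule (tbox K)) + progSize (map rboxRule (rbox K))
    ≤⟨ +-mono-≤ (sum-map-∘-scaled ruleSize tboxRule axiomSize 6 (tbox K) (λ a → m≤m*n 6 (axiomSize a)))
                (sum-map-∘-scaled ruleSize rboxRule (λ _ → 3) 6 (rbox K) (λ _ → lit-≤)) ⟩
  6 * sum (map axiomSize (tbox K)) + 6 * sum (map (λ _ → 3) (rbox K))
    ≡⟨ *-distribˡ-+ 6 (sum (map axiomSize (tbox K))) _ ⟨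
  6 * kbSize K ∎
  where open ≤-Reasoning

-- The rules attached to clos(Σ): at most 2|Σ| elements, each within budget.
closRules-size : ∀ K → progSize (concatMap rulesOf (closList K))
                       ≤ 2 * kbSize K * ruleBudget (suc (kbSize K))
closRules-size K =
  ≤-trans (sum-concatMap-≤ ruleSize rulesOf (ruleBudget (suc (kbSize K))) (closList K) within-budget)
          (*-monoˡ-≤ (ruleBudget (suc (kbSize K))) (closList-length K))
  where
  within-budget : ∀ {x} → x ∈ closList K → progSize (rulesOf x) ≤ ruleBudget (suc (kbSize K))
  within-budget {x} x∈ = ≤-trans (rulesOf-size x) (ruleBudget-mono (closList-size K x∈))

LΦ-size : ∀ K → progSize (LΦ K) ≤ 6 * kbSize K + 2 * kbSize K * ruleBudget (suc (kbSize K))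
LΦ-size K = begin
  progSize (tboxRules ++ rboxRules ++ closRules)                      ≡⟨ progSize-++ tboxRules _ ⟩
  progSize tboxRules + progSize (rboxRules ++ closRules)              ≡⟨ cong (progSize tboxRules +_) (progSize-++ rboxRules closRules) ⟩
  progSize tboxRules + (progSize rboxRules + progSize closRules)      ≡⟨ +-assoc (progSize tboxRules) _ _ ⟨
  progSize tboxRules + progSize rboxRules + progSize closRules        ≤⟨ +-mono-≤ (axiomRules-size K) (closRules-size K) ⟩
  6 * kbSize K + 2 * kbSize K * ruleBudget (suc (kbSize K))           ∎
  where
  open ≤-Reasoning
  tboxRules rboxRules closRules : Program
  tboxRules = map tboxRule (tbox K)
  rboxRules = map rboxRule (rbox K)
  closRules = concatMap rulesOf (closList K)

-- 6S + 32S(S+2)² ≤ 300S³ + 300 for S = k + 1, with the slack written out.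
size-identity : ∀ k → 6 * suc k + 2 * suc k * (16 * (suc (suc (suc k)) * suc (suc (suc k))))
                      + (268 * (k * (k * k)) + 676 * (k * k) + 414 * k + 306)
                    ≡ 300 * (suc k * (suc k * (suc k * 1))) + 300
size-identity = solve-∀

size-cubic : ∀ S → 6 * S + 2 * S * ruleBudget (suc S) ≤ 300 * S ^ 3 + 300
size-cubic zero    = z≤n
size-cubic (suc k) = ≤-by-slack _ (size-identity k)

≈S-refl : ∀ {A : Set} {xs : List A} → xs ≈S xs
≈S-refl = (λ p → p) , (λ p → p)

≈R-refl : ∀ {r} → r ≈R r
≈R-refl = ≈S-refl , ≈S-refl

X-distinct : VarsDistinct (vX ∷ [])
X-distinct = [] ∷ []

XY-distinct : VarsDistinct (vX ∷ vY ∷ [])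
XY-distinct = ((λ { x refl () }) ∷ []) ∷ ([] ∷ [])

local-ok : ∀ {s} → VarsDistinct (s ∷ []) → UnaryOK s [] []
local-ok d = [] , [] , d

_≟ᵀ_ : (t t' : Term) → Dec (t ≡ t')
var x ≟ᵀ var y with x ≟ y
... | yes refl = yes refl
... | no x≢y   = no λ { refl → x≢y refl }
var _ ≟ᵀ con _ = no λ ()
con _ ≟ᵀ var _ = no λ ()
con x ≟ᵀ con y with x ≟ y
... | yes refl = yes refl
... | no x≢y   = no λ { refl → x≢y refl }

var-injective : ∀ {x y} → var x ≡ var y → x ≡ y
var-injective refl = refl

map-var-distinct : ∀ l → AllPairs _≢_ l → VarsDistinct (map var l)
map-var-distinct l d =
  AllPairsP.map⁺ (AllPairs-map (λ a≢b x a≡x b≡x → a≢b (var-injective (trans a≡x (sym b≡x)))) d)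

-- ≥ n Q.E (X) ← Q(X,Y₁), E(Y₁), …, Q(X,Yₙ), E(Yₙ), (Yᵢ ≠ Yⱼ)ᵢ≠ⱼ is a unary
-- rule with one branch (Q, E) per Yᵢ and ψ listing the pairs of distinct terms.
module AtLeastRule (n : ℕ) (Q : RName) (E : Concept) where

  open AtLeastBody n Q E

  branchFor : ℕ → Branch
  branchFor i = branch (var i) ((⊕ , Q) ∷ []) ((⊕ , E) ∷ [])

  branches : List Branch
  branches = map branchFor (ys n)

  termAt : Fin (length branches) → Term
  termAt i = tm (lookup branches i)

  indexPairs : List (Fin (length branches) × Fin (length branches))
  indexPairs = cartesianProduct (allFin (length branches)) (allFin (length branches))

  distinct? : ∀ ij → Dec (termAt (proj₁ ij) ≢ termAt (proj₂ ij))
  distinct? ij = ¬? (termAt (proj₁ ij) ≟ᵀ termAt (proj₂ ij))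

  ψ : Psi branches
  ψ = filter distinct? indexPairs

  branchIndex : ∀ {k} → k ∈ ys n → ∃ λ (i : Fin (length branches)) → lookup branches i ≡ branchFor k
  branchIndex k∈ = Any.index p , sym (AnyP.lookup-index p)
    where p = ∈-map⁺ branchFor k∈

  branchAt : ∀ i → ∃ λ k → k ∈ ys n × lookup branches i ≡ branchFor k
  branchAt i = ∈-map⁻ branchFor (∈-lookup i)

  ψ-sound : psiLits branches ψ ⊆ neqs
  ψ-sound p with ∈-map⁻ _ p
  ... | (i , j) , ij∈ , refl with branchAt i | branchAt j | proj₂ (∈-filter⁻ distinct? {xs = indexPairs} ij∈)
  ... | a , a∈ , eqa | b , b∈ , eqb | ne =
        subst (_∈ neqs) (sym (cong₂ (λ u v → neq (tm u) (tm v)) eqa eqb))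
          (∈-concatMap-intro _ a∈ (∈-concatMap-intro _ b∈ (neqFor⁺ a b
             λ a≡b → ne (trans (cong tm eqa) (trans (cong var a≡b) (cong tm (sym eqb)))))))

  ψ-complete : neqs ⊆ psiLits branches ψ
  ψ-complete p with ∈-concatMap-elim _ (ys n) p
  ... | a , a∈ , p′ with ∈-concatMap-elim _ (ys n) p′
  ... | b , b∈ , p″ with neqFor⁻ a b p″ | branchIndex a∈ | branchIndex b∈
  ... | a≢b , refl | i , eqi | j , eqj =
        subst (_∈ psiLits branches ψ) (cong₂ (λ u v → neq (tm u) (tm v)) eqi eqj)
          (∈-map⁺ _ (∈-filter⁺ distinct? (∈-cartesianProduct⁺ (∈-allFin i) (∈-allFin j))
             λ e → a≢b (var-injective (trans (cong tm (sym eqi)) (trans e (cong tm eqj))))))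

  branchLits⊆ : concatMap (branchLits vX) branches ⊆ roles ++ concepts
  branchLits⊆ p with ∈-concatMap-elim (branchLits vX) branches p
  ... | b , b∈ , p′ with ∈-map⁻ branchFor b∈
  ... | k , k∈ , refl with p′
  ...   | here refl         = ∈-++⁺ˡ (∈-map⁺ roleAt k∈)
  ...   | there (here refl) = ∈-++⁺ʳ roles (∈-map⁺ conceptAt k∈)

  branchLits⊇ : roles ++ concepts ⊆ concatMap (branchLits vX) branches
  branchLits⊇ p with ∈-++⁻ roles p
  ... | inj₁ q with ∈-map⁻ roleAt q
  ...   | k , k∈ , refl = ∈-concatMap-intro (branchLits vX) (∈-map⁺ branchFor k∈) (here refl)
  branchLits⊇ p | inj₂ q with ∈-map⁻ conceptAt q
  ...   | k , k∈ , refl = ∈-concatMap-intro (branchLits vX) (∈-map⁺ branchFor k∈) (there (here refl))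

  body≈ : unaryBody vX [] branches ψ ≈S geBody n Q E
  body≈ = ⊆-trans (++⁺ branchLits⊆ ψ-sound) (⊆-reflexive (++-assoc roles concepts neqs))
        , ⊆-trans (⊆-reflexive (sym (++-assoc roles concepts neqs))) (++⁺ branchLits⊇ ψ-complete)

  Ys-distinct : AllPairs _≢_ (0 ∷ ys n)
  Ys-distinct = AllP.map⁺ (All.universal (λ _ ()) (upTo n))
              ∷ AllPairsP.map⁺ (AllPairsP.applyUpTo⁺₁ (λ i → i) n
                                  (λ i<j _ e → <⇒≢ i<j (suc-injective e)))

  rule-ok : UnaryOK vX branches ψ
  rule-ok = AllP.map⁺ (All.universal (λ _ _ → here refl) (ys n))
          , All.tabulate (λ ij∈ i≡j → proj₂ (∈-filter⁻ distinct? {xs = indexPairs} ij∈) (cong termAt i≡j))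
          , subst (λ ts → VarsDistinct (vX ∷ ts)) (map-∘ {g = tm} {f = branchFor} (ys n))
                  (map-var-distinct (0 ∷ ys n) Ys-distinct)

  atLeast-folp : FoLPRule ([ pos (un (cGe n Q E) vX) ] ⇐ geBody n Q E)
  atLeast-folp = unary (cGe n Q E) vX [] branches ψ , rule-ok , ≈S-refl , body≈

Φ-folp : ∀ {K r} → InΦ K r → FoLPRule r
Φ-folp (φ-tbox {C} {D} _)   = constrU vX ((⊕ , C) ∷ (⊖ , D) ∷ []) [] [] , local-ok X-distinct , ≈R-refl
Φ-folp (φ-rbox {R} {S} _)   = constrB vX vY [] ((⊕ , R) ∷ (⊖ , S) ∷ []) [] , ((λ _ → here refl) , XY-distinct) , ≈R-refl
Φ-folp (φ-atom {A} _)       = freeU (cAtom A) vX , tt , ≈R-refl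
Φ-folp (φ-role {R} _)       = freeB R vX vY , XY-distinct , ≈R-refl
Φ-folp (φ-nom {o} _)        = unary (cNom o) (con o) [] [] [] , local-ok ([] ∷ []) , ≈R-refl
Φ-folp (φ-not {E} _)        = unary (cNot E) vX ((⊖ , E) ∷ []) [] [] , local-ok X-distinct , ≈R-refl
Φ-folp (φ-and {E} {F} _)    = unary (cAnd E F) vX ((⊕ , E) ∷ (⊕ , F) ∷ []) [] [] , local-ok X-distinct , ≈R-refl
Φ-folp (φ-or-l {E} {F} _)   = unary (cOr E F) vX ((⊕ , E) ∷ []) [] [] , local-ok X-distinct , ≈R-refl
Φ-folp (φ-or-r {E} {F} _)   = unary (cOr E F) vX ((⊕ , F) ∷ []) [] [] , local-ok X-distinct , ≈R-refl
Φ-folp (φ-some {Q} {E} _)   = unary (cSome Q E) vX [] (branch vY ((⊕ , Q) ∷ []) ((⊕ , E) ∷ []) ∷ []) []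
                            , (((λ _ → here refl) ∷ []) , [] , XY-distinct) , ≈R-refl
Φ-folp (φ-all {R} {E} _)    = unary (cAll R E) vX ((⊖ , cSome R (cNot E)) ∷ []) [] [] , local-ok X-distinct , ≈R-refl
Φ-folp (φ-le {n} {Q} {E} _) = unary (cLe n Q E) vX ((⊖ , cGe (suc n) Q E) ∷ []) [] [] , local-ok X-distinct , ≈R-refl
Φ-folp (φ-ge {n} {Q} {E} _) = AtLeastRule.atLeast-folp n Q E

predOf : Atom → Pred
predOf (un c _)    = up c
predOf (bin f _ _) = bp f

HeadPred : Rule → Pred → Set
HeadPred r p = ∃ λ a → predOf a ≡ p × pos a ∈ hd r

BodyPred : Rule → Pred → Set
BodyPred r q = ∃ λ b → predOf b ≡ q × lit (pos b) ∈ bd r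

posOf⁻ : ∀ {A : Set} (xs : List (Sign × A)) {c} → c ∈ posOf xs → (⊕ , c) ∈ xs
posOf⁻ ((⊕ , a) ∷ xs) (here refl) = here refl
posOf⁻ ((⊕ , a) ∷ xs) (there p)   = there (posOf⁻ xs p)
posOf⁻ ((⊖ , a) ∷ xs) p           = there (posOf⁻ xs p)

data ArcTarget (β : List (Sign × Concept)) (γ : List (Sign × RName)) (δ : List (Sign × Concept))
               : Pred → Set where
  fromβ : ∀ {c} → (⊕ , c) ∈ β → ArcTarget β γ δ (up c)
  fromγ : ∀ {f} → (⊕ , f) ∈ γ → ArcTarget β γ δ (bp f)
  fromδ : ∀ {c} → (⊕ , c) ∈ δ → ArcTarget β γ δ (up c)

arcsFrom⁻ : ∀ {p p′ q m} β γ δ → (p′ , q , m) ∈ arcsFrom p β γ δ → p′ ≡ p × ArcTarget β γ δ q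
arcsFrom⁻ {p} β γ δ x with ∈-++⁻ (map (λ c → (p , up c , false)) (posOf β)) x
... | inj₁ y with ∈-map⁻ (λ c → (p , up c , false)) y
...   | c , c∈ , refl = refl , fromβ (posOf⁻ β c∈)
arcsFrom⁻ {p} β γ δ x | inj₂ y with ∈-++⁻ (map (λ f → (p , bp f , false)) (posOf γ)) y
... | inj₁ z with ∈-map⁻ (λ f → (p , bp f , false)) z
...   | f , f∈ , refl = refl , fromγ (posOf⁻ γ f∈)
arcsFrom⁻ {p} β γ δ x | inj₂ y | inj₂ z with ∈-map⁻ (λ c → (p , up c , true)) z
...   | c , c∈ , refl = refl , fromδ (posOf⁻ δ c∈)

uLits⁺ : ∀ s β {c} → (⊕ , c) ∈ β → lit (pos (un c s)) ∈ uLits s β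
uLits⁺ s β = ∈-map⁺ (λ { (σ , c) → lit (sgn σ (un c s)) })

bLits⁺ : ∀ s t γ {f} → (⊕ , f) ∈ γ → lit (pos (bin f s t)) ∈ bLits s t γ
bLits⁺ s t γ = ∈-map⁺ (λ { (σ , f) → lit (sgn σ (bin f s t)) })

branch-in-body : ∀ {s ms b l} β (ψ : Psi ms) → b ∈ ms → l ∈ branchLits s b → l ∈ unaryBody s β ms ψ
branch-in-body {s} β ψ b∈ l∈ = ∈-++⁺ʳ (uLits s β) (∈-++⁺ˡ (∈-concatMap-intro (branchLits s) b∈ l∈))

arcs-endpoints : ∀ w {p q m} → (p , q , m) ∈ arcs w → HeadPred (toRule w) p × BodyPred (toRule w) q
arcs-endpoints (unary a s β ms ψ) x with ∈-++⁻ (arcsFrom (up a) β [] []) x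
... | inj₁ y with arcsFrom⁻ β [] [] y
...   | refl , fromβ {c} c∈ = (un a s , refl , here refl) , (un c s , refl , ∈-++⁺ˡ (uLits⁺ s β c∈))
arcs-endpoints (unary a s β ms ψ) x | inj₂ y
  with ∈-concatMap-elim (λ b → arcsFrom (up a) [] (γm b) (δm b)) ms y
... | b , b∈ , z with arcsFrom⁻ [] (γm b) (δm b) z
...   | refl , fromγ {f} f∈ = (un a s , refl , here refl) ,
          (bin f s (tm b) , refl , branch-in-body β ψ b∈ (∈-++⁺ˡ (bLits⁺ s (tm b) (γm b) f∈)))
...   | refl , fromδ {c} c∈ = (un a s , refl , here refl) ,
          (un c (tm b) , refl , branch-in-body β ψ b∈ (∈-++⁺ʳ (bLits s (tm b) (γm b)) (uLits⁺ (tm b) (δm b) c∈)))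
arcs-endpoints (binary f s t β γ δ) x with arcsFrom⁻ β γ δ x
... | refl , fromβ {c} c∈ = (bin f s t , refl , here refl) , (un c s , refl , ∈-++⁺ˡ (uLits⁺ s β c∈))
... | refl , fromγ {g} g∈ = (bin f s t , refl , here refl) ,
                            (bin g s t , refl , ∈-++⁺ʳ (uLits s β) (∈-++⁺ˡ (bLits⁺ s t γ g∈)))
... | refl , fromδ {c} c∈ = (bin f s t , refl , here refl) ,
                            (un c t , refl , ∈-++⁺ʳ (uLits s β) (∈-++⁺ʳ (bLits s t γ) (uLits⁺ t δ c∈)))

arcs-endpoints-≈ : ∀ {r w p q m} → toRule w ≈R r → (p , q , m) ∈ arcs w → HeadPred r p × BodyPred r q
arcs-endpoints-≈ {w = w} ((hd⊆ , _) , (bd⊆ , _)) x with arcs-endpoints w x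
... | (a , refl , a∈) , (b , refl , b∈) = (a , refl , hd⊆ a∈) , (b , refl , bd⊆ b∈)

-- Atomic concepts and roles (the only predicates P may use) have rank 0.
rank : Pred → ℕ
rank (bp _)         = 0
rank (up (cAtom _)) = 0
rank (up c)         = csize c

rank≤csize : ∀ c → rank (up c) ≤ csize c
rank≤csize (cAtom _)   = z≤n
rank≤csize (cNom _)    = ≤-refl
rank≤csize (cNot _)    = ≤-refl
rank≤csize (cAnd _ _)  = ≤-refl
rank≤csize (cOr _ _)   = ≤-refl
rank≤csize (cSome _ _) = ≤-refl
rank≤csize (cAll _ _)  = ≤-refl
rank≤csize (cGe _ _ _) = ≤-refl
rank≤csize (cLe _ _ _) = ≤-refl

geBody-atoms : ∀ n Q E {b} → lit (pos b) ∈ geBody n Q E →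
               (∃ λ t → ∃ λ t′ → b ≡ bin Q t t′) ⊎ (∃ λ t → b ≡ un E t)
geBody-atoms n Q E p with ∈-++⁻ (AtLeastBody.roles n Q E) p
... | inj₁ q with ∈-map⁻ (AtLeastBody.roleAt n Q E) q
...   | _ , _ , refl = inj₁ (_ , _ , refl)
geBody-atoms n Q E p | inj₂ q with ∈-++⁻ (AtLeastBody.concepts n Q E) q
... | inj₁ r with ∈-map⁻ (AtLeastBody.conceptAt n Q E) r
...   | _ , _ , refl = inj₂ (_ , refl)
geBody-atoms n Q E p | inj₂ q | inj₂ r with ∈-concatMap-elim _ (ys n) r
... | i , _ , r′ with ∈-concatMap-elim _ (ys n) r′
... | j , _ , r″ with neqFor⁻ i j r″
... | _ , ()

Φ-rank-decreasing : ∀ {K r a b} → InΦ K r → pos a ∈ hd r → lit (pos b) ∈ bd r →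
                    rank (predOf b) < rank (predOf a)
Φ-rank-decreasing (φ-tbox _) () _
Φ-rank-decreasing (φ-rbox _) () _
Φ-rank-decreasing (φ-atom _) _ ()
Φ-rank-decreasing (φ-role _) _ ()
Φ-rank-decreasing (φ-nom _)  _ ()
Φ-rank-decreasing (φ-not _)  _ (here ())
Φ-rank-decreasing (φ-not _)  _ (there ())
Φ-rank-decreasing (φ-all _)  _ (here ())
Φ-rank-decreasing (φ-all _)  _ (there ())
Φ-rank-decreasing (φ-le _)   _ (here ())
Φ-rank-decreasing (φ-le _)   _ (there ())
Φ-rank-decreasing (φ-and {E} _) (here refl) (here refl) = s≤s (≤-trans (rank≤csize E) (m≤m+n _ _))
Φ-rank-decreasing (φ-and {F = F} _) (here refl) (there (here refl)) = s≤s (≤-trans (rank≤csize F) (m≤n+m _ _))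
Φ-rank-decreasing (φ-or-l {E} _) (here refl) (here refl) = s≤s (≤-trans (rank≤csize E) (m≤m+n _ _))
Φ-rank-decreasing (φ-or-r {F = F} _) (here refl) (here refl) = s≤s (≤-trans (rank≤csize F) (m≤n+m _ _))
Φ-rank-decreasing (φ-some _) (here refl) (here refl) = s≤s z≤n
Φ-rank-decreasing (φ-some {E = E} _) (here refl) (there (here refl)) = s≤s (≤-trans (rank≤csize E) (n≤1+n _))
Φ-rank-decreasing (φ-ge {n} {Q} {E} _) (here refl) b∈ with geBody-atoms n Q E b∈
... | inj₁ (_ , _ , refl) = s≤s z≤n
... | inj₂ (_ , refl) = s≤s (≤-trans (rank≤csize E) (≤-trans (m≤n+m (csize E) n) (n≤1+n _)))

atomic-rank : ∀ {a} → AtomOK a → rank (predOf a) ≡ 0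
atomic-rank {un _ _}    (_ , refl) = refl
atomic-rank {bin _ _ _} _          = refl

module Simplicity (K : KB) (L P : Program) (isΦ : IsΦ K L) (atomic : AtomicPreds P) where

  free-++ : ∀ {p} → Free P p → Free (L ++ P) p
  free-++ {up a} (x , r∈)           = x , AnyP.++⁺ʳ L r∈
  free-++ {bp f} (x , y , x≢y , r∈) = x , y , x≢y , AnyP.++⁺ʳ L r∈

  arc-cases : ∀ {p q m} → ArcM (L ++ P) p q m →
              rank q < rank p ⊎ (ArcM P p q m × rank p ≡ 0 × rank q ≡ 0)
  arc-cases (p-nonfree , q-nonfree , r∈) with AnyP.++⁻ L r∈
  ... | inj₁ inL with find inL
  ...   | r , r∈L , (w , _ , w≈r , arc∈) with arcs-endpoints-≈ {w = w} w≈r arc∈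
  ...     | (a , refl , a∈) , (b , refl , b∈) =
            inj₁ (Φ-rank-decreasing (Equivalence.to (isΦ r) r∈L) a∈ b∈)
  arc-cases (p-nonfree , q-nonfree , r∈) | inj₂ inP with find inP
  ... | r , r∈P , (w , _ , w≈r , arc∈) with arcs-endpoints-≈ {w = w} w≈r arc∈ | All.lookup atomic r∈P
  ...   | (a , refl , a∈) , (b , refl , b∈) | (hd-atomic , bd-atomic) =
          inj₂ ( (p-nonfree ∘ free-++ , q-nonfree ∘ free-++ , inP)
               , atomic-rank (All.lookup hd-atomic a∈) , atomic-rank (All.lookup bd-atomic b∈))

  path-rank : ∀ {p q} → Star (Arc (L ++ P)) p q → rank q ≤ rank p
  path-rank ε = ≤-refl
  path-rank ((_ , arc) ◅ path) with arc-cases arc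
  ... | inj₁ lt            = ≤-trans (path-rank path) (<⇒≤ lt)
  ... | inj₂ (_ , p0 , q0) = ≤-trans (path-rank path) (≤-reflexive (trans q0 (sym p0)))

  path-in-P : ∀ {p q} → Star (Arc (L ++ P)) p q → rank p ≡ 0 → Star (Arc P) p q
  path-in-P ε _ = ε
  path-in-P ((m , arc) ◅ path) p0 with arc-cases arc
  ... | inj₁ lt              = ⊥-elim (n≮0 (subst (_ <_) p0 lt))
  ... | inj₂ (arcP , _ , q0) = (m , arcP) ◅ path-in-P path q0

  -- A marked arc from Φ(Σ) descends in rank, so no path leads back; a marked
  -- arc from P starts a rank-0 path, which lies in D(P) and is excluded there.
  simple : SimpleFoLP P → SimpleFoLP (L ++ P)
  simple (P-folp , P-acyclic) = AllP.++⁺ L-folp P-folp , no-marked-cycle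
    where
    L-folp : IsFoLP L
    L-folp = All.tabulate (λ {r} r∈ → Φ-folp (Equivalence.to (isΦ r) r∈))
    no-marked-cycle : ∀ p q → ArcM (L ++ P) p q true → ¬ Star (Arc (L ++ P)) q p
    no-marked-cycle p q arc path with arc-cases arc
    ... | inj₁ lt              = <⇒≱ lt (path-rank path)
    ... | inj₂ (arcP , _ , q0) = P-acyclic p q arcP (path-in-P path q0)

proposition17 : Σ ℕ λ c → Σ ℕ λ d → ∀ (K : KB) (P : Program) → SimpleFHybrid K P →
    (∀ (L : Program) → IsΦ K L → SimpleFoLP (L ++ P))
    × (Σ Program λ L → IsΦ K L × (progSize L ≤ c * (kbSize K ^ d) + c))
proposition17 = 300 , 3 , λ K P (atomic , P-simple) →
    (λ L isΦ → Simplicity.simple K L P isΦ atomic P-simple)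
  , (LΦ K , LΦ-isΦ K , ≤-trans (LΦ-size K) (size-cubic (kbSize K)))
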